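{- Let $q$ be a prime power and $A\subseteq\mathbb{F}_q$ with $0\notin A$ and $|A|>q^{2/3}$. Then there exists $a\in A$ such that \[ |A(a+A)|>\frac q2, \] where $A(a+A)=\{b(a+c): b,c\in A\}$. -}

module Defs where

open import Data.Nat using (ℕ; _≥_)
open import Data.Nat.Primality using (Prime)
open import Data.Fin using (Fin; _≟_)
open import Data.Fin.Properties using (any?)
open import Data.Fin.Subset using (Subset; _∈_)
open import Data.Fin.Subset.Properties using (_∈?_)
open import Data.Vec using (tabulate)
open import Data.Product using (Σ; ∃; _×_)
open import Relation.Nullary using (¬_; does)
open import Relation.Nullary.Decidable using (_×-dec_)
open import Relation.Binary.PropositionalEquality using (_≡_)
open import Algebra.Structures using (IsCommutativeRing)

IsPrimePower : ℕ → Set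
IsPrimePower q = Σ ℕ λ p → Σ ℕ λ k → Prime p × k ≥ 1 × q ≡ p Data.Nat.^ k

-- Every finite field of order q is (isomorphic to) one of these, and F_q is
-- unique up to isomorphism, so quantifying over all such structures is
-- quantifying over "the" field F_q.
record FieldOn (q : ℕ) : Set where
  field
    _+_ _*_ : Fin q → Fin q → Fin q
    -_      : Fin q → Fin q
    0# 1#   : Fin q
    isCommutativeRing : IsCommutativeRing _≡_ _+_ _*_ -_ 0# 1#
    0≢1     : ¬ (0# ≡ 1#)
    inverse : ∀ x → ¬ (x ≡ 0#) → ∃ λ y → x * y ≡ 1#

prodSumSet : ∀ {q} → FieldOn q → Subset q → Fin q → Subset q
prodSumSet {q} F A a = tabulate λ x →
  does (any? λ b → any? λ c → (b ∈? A) ×-dec ((c ∈? A) ×-dec (x ≟ b * (a + c))))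
  where open FieldOn F

-- For a ∈ F_q let r_a(x) be the number of pairs (b, c) ∈ A² with b(a + c) = x. Since
-- Σ_x r_a(x) = |A|², Cauchy–Schwarz gives |A|⁴ ≤ |A(a+A)| · E_a with E_a = Σ_x r_a(x)².
-- Summed over all a ∈ F_q, E_a counts quadruples (b, c, b', c') ∈ A⁴ together with a
-- solution a of b(a + c) = b'(a + c'): there is at most one if b ≠ b', none if b = b' and
-- c ≠ c' (as b ≠ 0), and q on the |A|² diagonal quadruples; so Σ_a E_a ≤ |A|⁴ + q|A|².
-- If 2|A(a+A)| ≤ q for all a ∈ A then, with |A(a+A)| ≤ q for a ∉ A,
-- |A|⁴(q + |A|) ≤ q Σ_a E_a ≤ q(|A|⁴ + q|A|²), that is |A|³ ≤ q².

module Submission where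

open import Defs
open import Algebra.Bundles using (CommutativeRing)
open import Data.Bool using (Bool; true; false)
open import Data.Empty using (⊥-elim)
open import Data.Fin using (Fin; zero; suc)
open import Data.Fin.Properties using (_≟_; suc-injective; any?)
open import Data.Fin.Subset using (Subset; _∈_; _∉_; ∣_∣)
open import Data.Fin.Subset.Properties using (_∈?_; ∣p∣≤n)
open import Data.Maybe using (nothing)
open import Data.Nat using (ℕ; zero; suc; _+_; _*_; _^_; _≤_; _<_; _<?_; z≤n; s≤s)
open import Data.Nat.Properties hiding (_≟_; suc-injective)
open import Data.Nat.Tactic.RingSolver using (solve-∀)
open import Data.Product using (∃; _×_; _,_)
open import Data.Sum using (inj₁; inj₂)
open import Data.Vec using (_∷_; []; tabulate)
open import Function using (_∘_)
open import Relation.Binary.PropositionalEquality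
open import Relation.Nullary using (Dec; yes; no; does; ¬_; contradiction)
open import Relation.Nullary.Decidable using (_×-dec_)
open import Relation.Unary using (Pred; Decidable)
open import Tactic.RingSolver.Core.AlmostCommutativeRing using (fromCommutativeRing)
open import Algebra.Properties.Semiring.Sum +-*-semiring
  using (sum; sum-syntax; sum-cong-≗; sum-replicate-zero; ∑-distrib-+; ∑-comm; *-distribˡ-sum; *-distribʳ-sum)

∑-mono-≤ : ∀ {n} {f g : Fin n → ℕ} → (∀ i → f i ≤ g i) → sum f ≤ sum g
∑-mono-≤ {zero}  f≤g = z≤n
∑-mono-≤ {suc n} f≤g = +-mono-≤ (f≤g zero) (∑-mono-≤ (f≤g ∘ suc))

∑-const-1 : ∀ n → ∑[ i < n ] 1 ≡ n
∑-const-1 zero    = refl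
∑-const-1 (suc n) = cong suc (∑-const-1 n)

∑-≤-card : ∀ {n} {f : Fin n → ℕ} → (∀ i → f i ≤ 1) → sum f ≤ n
∑-≤-card {n} f≤1 = ≤-trans (∑-mono-≤ f≤1) (≤-reflexive (∑-const-1 n))

∑-zero : ∀ {n} {f : Fin n → ℕ} → (∀ i → f i ≡ 0) → sum f ≡ 0
∑-zero {n} f≡0 = trans (sum-cong-≗ f≡0) (sum-replicate-zero n)

∑∑ : ∀ {m n} → (Fin m → Fin n → ℕ) → ℕ
∑∑ f = sum (λ i → sum (f i))

∑∑-cong : ∀ {m n} {f g : Fin m → Fin n → ℕ} → (∀ i j → f i j ≡ g i j) → ∑∑ f ≡ ∑∑ g
∑∑-cong f≡g = sum-cong-≗ (λ i → sum-cong-≗ (f≡g i))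

∑∑-mono-≤ : ∀ {m n} {f g : Fin m → Fin n → ℕ} → (∀ i j → f i j ≤ g i j) → ∑∑ f ≤ ∑∑ g
∑∑-mono-≤ f≤g = ∑-mono-≤ (λ i → ∑-mono-≤ (f≤g i))

∑∑-distrib-+ : ∀ {m n} (f g : Fin m → Fin n → ℕ) →
               ∑∑ (λ i j → f i j + g i j) ≡ ∑∑ f + ∑∑ g
∑∑-distrib-+ f g = trans (sum-cong-≗ (λ i → ∑-distrib-+ (f i) (g i)))
                         (∑-distrib-+ (sum ∘ f) (sum ∘ g))

∑∑-*ˡ : ∀ {m n} c (f : Fin m → Fin n → ℕ) → ∑∑ (λ i j → c * f i j) ≡ c * ∑∑ f
∑∑-*ˡ c f = sym (trans (*-distribˡ-sum c (sum ∘ f))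
                       (sum-cong-≗ (λ i → *-distribˡ-sum c (f i))))

∑∑-*ʳ : ∀ {m n} c (f : Fin m → Fin n → ℕ) → ∑∑ f * c ≡ ∑∑ (λ i j → f i j * c)
∑∑-*ʳ c f = trans (*-distribʳ-sum c (sum ∘ f))
                  (sum-cong-≗ (λ i → *-distribʳ-sum c (f i)))

∑-∑∑-comm : ∀ {k m n} (f : Fin k → Fin m → Fin n → ℕ) →
            sum (λ a → ∑∑ (f a)) ≡ ∑∑ (λ i j → sum (λ a → f a i j))
∑-∑∑-comm f = trans (∑-comm (λ a i → sum (f a i)))
                    (sum-cong-≗ (λ i → ∑-comm (λ a → f a i)))

∑-∑∑-*ˡ : ∀ {k m n} (w : Fin m → Fin n → ℕ) (f : Fin k → Fin m → Fin n → ℕ) →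
           sum (λ a → ∑∑ (λ i j → w i j * f a i j)) ≡ ∑∑ (λ i j → w i j * sum (λ a → f a i j))
∑-∑∑-*ˡ w f = trans (∑-∑∑-comm (λ a i j → w i j * f a i j))
                    (∑∑-cong (λ i j → sym (*-distribˡ-sum (w i j) (λ a → f a i j))))

∑-*-∑ : ∀ {m n} (f : Fin m → ℕ) (g : Fin n → ℕ) → sum f * sum g ≡ ∑∑ (λ i j → f i * g j)
∑-*-∑ f g = trans (*-distribʳ-sum (sum g) f)
                  (sum-cong-≗ (λ i → *-distribˡ-sum (f i) g))

x≤y⇒2xy≤x²+y² : ∀ {x y} → x ≤ y → 2 * (x * y) ≤ x * x + y * y
x≤y⇒2xy≤x²+y² {x} x≤y with m≤n⇒∃[o]m+o≡n x≤y
... | d , refl = ≤-trans (m≤m+n _ (d * d)) (≤-reflexive (expand x d))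
  where
  expand : ∀ x d → 2 * (x * (x + d)) + d * d ≡ x * x + (x + d) * (x + d)
  expand = solve-∀

2xy≤x²+y² : ∀ x y → 2 * (x * y) ≤ x * x + y * y
2xy≤x²+y² x y with ≤-total x y
... | inj₁ x≤y = x≤y⇒2xy≤x²+y² x≤y
... | inj₂ y≤x = subst₂ _≤_ (cong (2 *_) (*-comm y x)) (+-comm (y * y) (x * x))
                        (x≤y⇒2xy≤x²+y² y≤x)

cauchy-schwarz : ∀ {n} (f g : Fin n → ℕ) →
  sum (λ i → f i * g i) * sum (λ i → f i * g i)
    ≤ sum (λ i → f i * f i) * sum (λ i → g i * g i)
cauchy-schwarz f g = *-cancelˡ-≤ 2 (begin
  2 * (sum fg * sum fg)                                   ≡⟨ cong (2 *_) (∑-*-∑ fg fg) ⟩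
  2 * ∑∑ (λ i j → fg i * fg j)                            ≡⟨ ∑∑-*ˡ 2 (λ i j → fg i * fg j) ⟨
  ∑∑ (λ i j → 2 * (fg i * fg j))                          ≤⟨ ∑∑-mono-≤ term ⟩
  ∑∑ (λ i j → ff i * gg j + ff j * gg i)                  ≡⟨ ∑∑-distrib-+ (λ i j → ff i * gg j) (λ i j → ff j * gg i) ⟩
  ∑∑ (λ i j → ff i * gg j) + ∑∑ (λ i j → ff j * gg i)     ≡⟨ cong (P +_) (∑-comm (λ i j → ff j * gg i)) ⟩
  P + P                                                   ≡⟨ cong (P +_) (+-identityʳ P) ⟨
  2 * P                                                   ≡⟨ cong (2 *_) (∑-*-∑ ff gg) ⟨
  2 * (sum ff * sum gg)                                   ∎)
  where
  open ≤-Reasoning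
  fg = λ i → f i * g i
  ff = λ i → f i * f i
  gg = λ i → g i * g i
  P = ∑∑ (λ i j → ff i * gg j)
  regroup : ∀ a b c d → 2 * ((a * b) * (c * d)) ≡ 2 * ((a * d) * (c * b))
  regroup = solve-∀
  squares : ∀ a b c d → (a * d) * (a * d) + (c * b) * (c * b) ≡ (a * a) * (d * d) + (c * c) * (b * b)
  squares = solve-∀
  term : ∀ i j → 2 * (fg i * fg j) ≤ ff i * gg j + ff j * gg i
  term i j = subst₂ _≤_ (sym (regroup (f i) (g i) (f j) (g j))) (squares (f i) (g i) (f j) (g j))
                        (2xy≤x²+y² (f i * g j) (f j * g i))

𝟙 : Bool → ℕ
𝟙 true  = 1
𝟙 false = 0

𝟙-idem : ∀ x → 𝟙 x * 𝟙 x ≡ 𝟙 x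
𝟙-idem true  = refl
𝟙-idem false = refl

𝟙≤1 : ∀ x → 𝟙 x ≤ 1
𝟙≤1 true  = s≤s z≤n
𝟙≤1 false = z≤n

𝟙-does-*-support : ∀ {p} {P : Set p} (P? : Dec P) m → (¬ P → m ≡ 0) → 𝟙 (does P?) * m ≡ m
𝟙-does-*-support (yes _) m _    = +-identityʳ m
𝟙-does-*-support (no ¬p) m m≡0 = sym (m≡0 ¬p)

δ : ∀ {n} → Fin n → Fin n → ℕ
δ i j = 𝟙 (does (i ≟ j))

∑-δ : ∀ {n} (j : Fin n) (g : Fin n → ℕ) → sum (λ i → δ i j * g i) ≡ g j
∑-δ {suc n} zero    g = trans (cong₂ _+_ (*-identityˡ (g zero)) (∑-zero {n} (λ _ → refl))) (+-identityʳ (g zero))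
∑-δ {suc n} (suc j) g = ∑-δ j (g ∘ suc)

∣tabulate∣≡∑ : ∀ {n} (p : Fin n → Bool) → ∣ tabulate p ∣ ≡ sum (𝟙 ∘ p)
∣tabulate∣≡∑ {zero}  p = refl
∣tabulate∣≡∑ {suc n} p with p zero
... | true  = cong suc (∣tabulate∣≡∑ (p ∘ suc))
... | false = ∣tabulate∣≡∑ (p ∘ suc)

∣A∣≡∑ : ∀ {n} (A : Subset n) → ∣ A ∣ ≡ sum (λ i → 𝟙 (does (i ∈? A)))
∣A∣≡∑ []          = refl
∣A∣≡∑ (true ∷ A)  = cong suc (∣A∣≡∑ A)
∣A∣≡∑ (false ∷ A) = ∣A∣≡∑ A

∑-unique≤1 : ∀ {n p} {P : Pred (Fin n) p} (P? : Decidable P) →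
             (∀ i j → P i → P j → i ≡ j) → sum (λ i → 𝟙 (does (P? i))) ≤ 1
∑-unique≤1 {zero}  P? unique = z≤n
∑-unique≤1 {suc n} P? unique with P? zero
... | yes P0 = ≤-reflexive (cong suc (∑-zero absent))
  where
  absent : ∀ i → 𝟙 (does (P? (suc i))) ≡ 0
  absent i with P? (suc i)
  ... | yes Pi with () ← unique zero (suc i) P0 Pi
  ... | no _ = refl
... | no _ = ∑-unique≤1 (P? ∘ suc) (λ i j Pi Pj → suc-injective (unique (suc i) (suc j) Pi Pj))

module FieldFacts {q : ℕ} (F : FieldOn q) where

  commutativeRing : CommutativeRing _ _
  commutativeRing = record { isCommutativeRing = FieldOn.isCommutativeRing F }

  module R = CommutativeRing commutativeRing
  open CommutativeRing commutativeRing using (-_; 0#) renaming (_+_ to _+ᶠ_; _*_ to _*ᶠ_; _-_ to _-ᶠ_)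
  open FieldOn F using (inverse)
  open import Algebra.Properties.Group R.+-group using (∙-cancelˡ; ∙-cancelʳ; x∙y⁻¹≈ε⇒x≈y)

  open import Tactic.RingSolver.NonReflective (fromCommutativeRing commutativeRing (λ _ → nothing))

  *-cancelˡ : ∀ {d} x y → ¬ d ≡ 0# → d *ᶠ x ≡ d *ᶠ y → x ≡ y
  *-cancelˡ {d} x y d≢0 dx≡dy with inverse d d≢0
  ... | d⁻¹ , dd⁻¹≡1 = begin
    x                 ≡⟨ scale x ⟨
    d⁻¹ *ᶠ (d *ᶠ x)   ≡⟨ cong (d⁻¹ *ᶠ_) dx≡dy ⟩
    d⁻¹ *ᶠ (d *ᶠ y)   ≡⟨ scale y ⟩
    y                 ∎
    where
    open ≡-Reasoning
    scale : ∀ z → d⁻¹ *ᶠ (d *ᶠ z) ≡ z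
    scale z = trans (sym (R.*-assoc d⁻¹ d z))
                    (trans (cong (_*ᶠ z) (trans (R.*-comm d⁻¹ d) dd⁻¹≡1)) (R.*-identityˡ z))

  *-+-cancelˡ : ∀ {b} a c c' → ¬ b ≡ 0# → b *ᶠ (a +ᶠ c) ≡ b *ᶠ (a +ᶠ c') → c ≡ c'
  *-+-cancelˡ a c c' b≢0 eq = ∙-cancelˡ a c c' (*-cancelˡ (a +ᶠ c) (a +ᶠ c') b≢0 eq)

  distinct-slopes-meet-once : ∀ {b b'} a a' c c' → ¬ b ≡ b' →
    b *ᶠ (a +ᶠ c) ≡ b' *ᶠ (a +ᶠ c') → b *ᶠ (a' +ᶠ c) ≡ b' *ᶠ (a' +ᶠ c') → a ≡ a'
  distinct-slopes-meet-once {b} {b'} a a' c c' b≢b' meet meet' =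
    *-cancelˡ a a' b-b'≢0 (∙-cancelʳ K ((b -ᶠ b') *ᶠ a) ((b -ᶠ b') *ᶠ a') (begin
      (b -ᶠ b') *ᶠ a +ᶠ K                          ≡⟨ cong (_+ᶠ K) (drop-zero a') ⟨
      ((b -ᶠ b') *ᶠ a +ᶠ (b' -ᶠ b') *ᶠ a') +ᶠ K     ≡⟨ expandˡ b b' (- b') a a' c c' ⟩
      (b *ᶠ (a +ᶠ c) +ᶠ b' *ᶠ (a' +ᶠ c')) +ᶠ M      ≡⟨ cong₂ (λ u v → (u +ᶠ v) +ᶠ M) meet (sym meet') ⟩
      (b' *ᶠ (a +ᶠ c') +ᶠ b *ᶠ (a' +ᶠ c)) +ᶠ M      ≡⟨ expandʳ b b' (- b') a a' c c' ⟨
      ((b -ᶠ b') *ᶠ a' +ᶠ (b' -ᶠ b') *ᶠ a) +ᶠ K     ≡⟨ cong (_+ᶠ K) (drop-zero a) ⟩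
      (b -ᶠ b') *ᶠ a' +ᶠ K                          ∎))
    where
    open ≡-Reasoning
    K = b *ᶠ c +ᶠ b' *ᶠ c'
    M = - b' *ᶠ a +ᶠ - b' *ᶠ a'
    b-b'≢0 : ¬ b -ᶠ b' ≡ 0#
    b-b'≢0 = b≢b' ∘ x∙y⁻¹≈ε⇒x≈y b b'
    drop-zero : ∀ {x} y → x +ᶠ (b' -ᶠ b') *ᶠ y ≡ x
    drop-zero {x} y = trans (cong (λ z → x +ᶠ z *ᶠ y) (R.-‿inverseʳ b'))
                            (trans (cong (x +ᶠ_) (R.zeroˡ y)) (R.+-identityʳ x))
    -- The solver cannot cancel x +ᶠ - x over an abstract ring, so - b' enters as a variable m.
    expandˡ : ∀ b b' m a a' c c' →
      ((b +ᶠ m) *ᶠ a +ᶠ (b' +ᶠ m) *ᶠ a') +ᶠ (b *ᶠ c +ᶠ b' *ᶠ c')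
        ≡ (b *ᶠ (a +ᶠ c) +ᶠ b' *ᶠ (a' +ᶠ c')) +ᶠ (m *ᶠ a +ᶠ m *ᶠ a')
    expandˡ = solve 7 (λ b b' m a a' c c' →
      (((b ⊕ m) ⊗ a ⊕ (b' ⊕ m) ⊗ a') ⊕ (b ⊗ c ⊕ b' ⊗ c'))
        ⊜ ((b ⊗ (a ⊕ c) ⊕ b' ⊗ (a' ⊕ c')) ⊕ (m ⊗ a ⊕ m ⊗ a'))) refl
    expandʳ : ∀ b b' m a a' c c' →
      ((b +ᶠ m) *ᶠ a' +ᶠ (b' +ᶠ m) *ᶠ a) +ᶠ (b *ᶠ c +ᶠ b' *ᶠ c')
        ≡ (b' *ᶠ (a +ᶠ c') +ᶠ b *ᶠ (a' +ᶠ c)) +ᶠ (m *ᶠ a +ᶠ m *ᶠ a')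
    expandʳ = solve 7 (λ b b' m a a' c c' →
      (((b ⊕ m) ⊗ a' ⊕ (b' ⊕ m) ⊗ a) ⊕ (b ⊗ c ⊕ b' ⊗ c'))
        ⊜ ((b' ⊗ (a ⊕ c') ⊕ b ⊗ (a' ⊕ c)) ⊕ (m ⊗ a ⊕ m ⊗ a'))) refl

m⁴[Q+m]≤Q[m⁴+Qm²]⇒m³≤Q² : ∀ m Q →
  (m * m) * (m * m) * (Q + m) ≤ Q * ((m * m) * (m * m) + Q * (m * m)) → m ^ 3 ≤ Q ^ 2
m⁴[Q+m]≤Q[m⁴+Qm²]⇒m³≤Q² zero    Q _ = z≤n
m⁴[Q+m]≤Q[m⁴+Qm²]⇒m³≤Q² m@(suc _) Q hyp =
  *-cancelˡ-≤ (m * m) (+-cancelˡ-≤ (Q * ((m * m) * (m * m))) _ _ (subst₂ _≤_ (lhs m Q) (rhs m Q) hyp))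
  where
  -- m ^ 3 and Q ^ 2 are spelled out: the ℕ solver does not normalise _^_ here.
  lhs : ∀ x y → (x * x) * (x * x) * (y + x) ≡ y * ((x * x) * (x * x)) + (x * x) * (x * (x * (x * 1)))
  lhs = solve-∀
  rhs : ∀ x y → y * ((x * x) * (x * x) + y * (x * x)) ≡ y * ((x * x) * (x * x)) + (x * x) * (y * (y * 1))
  rhs = solve-∀

module ProductSumCount {q : ℕ} (F : FieldOn q) (A : Subset q) (0∉A : FieldOn.0# F ∉ A) where

  open FieldOn F using (0#) renaming (_+_ to _+ᶠ_; _*_ to _*ᶠ_)
  open FieldFacts F using (*-+-cancelˡ; distinct-slopes-meet-once)

  χ : Fin q → ℕ
  χ b = 𝟙 (does (b ∈? A))

  n : ℕ
  n = ∣ A ∣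

  W : Fin q → Fin q → ℕ
  W b c = χ b * χ c

  v : Fin q → Fin q → Fin q → Fin q
  v a b c = b *ᶠ (a +ᶠ c)

  reps : Fin q → Fin q → ℕ
  reps a x = ∑∑ (λ b c → W b c * δ x (v a b c))

  collisions : Fin q → ℕ
  collisions a = sum (λ x → reps a x * reps a x)

  meets : Fin q → Fin q → Fin q → Fin q → ℕ
  meets b c b' c' = sum (λ a → δ (v a b c) (v a b' c'))

  -- The decision procedure inside prodSumSet, so that its indicator is inS.
  S? : ∀ a x → Dec (∃ λ b → ∃ λ c → b ∈ A × c ∈ A × x ≡ v a b c)
  S? a x = any? λ b → any? λ c → (b ∈? A) ×-dec ((c ∈? A) ×-dec (x ≟ v a b c))

  inS : Fin q → Fin q → ℕ
  inS a x = 𝟙 (does (S? a x))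

  ∣S∣≡∑inS : ∀ a → ∣ prodSumSet F A a ∣ ≡ sum (inS a)
  ∣S∣≡∑inS a = ∣tabulate∣≡∑ (λ x → does (S? a x))

  ∑∑W≡n² : ∑∑ W ≡ n * n
  ∑∑W≡n² = trans (sym (∑-*-∑ χ χ)) (cong₂ _*_ (sym (∣A∣≡∑ A)) (sym (∣A∣≡∑ A)))

  W-idem : ∀ b c → W b c * W b c ≡ W b c
  W-idem b c = trans ([m*n]*[o*p]≡[m*o]*[n*p] (χ b) (χ c) (χ b) (χ c))
                     (cong₂ _*_ (𝟙-idem (does (b ∈? A))) (𝟙-idem (does (c ∈? A))))

  W-monoʳ-≤ : ∀ b c {m k} → (b ∈ A → c ∈ A → m ≤ k) → W b c * m ≤ W b c * k
  W-monoʳ-≤ b c m≤k with b ∈? A | c ∈? A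
  ... | yes b∈A | yes c∈A = *-monoʳ-≤ 1 (m≤k b∈A c∈A)
  ... | no _    | _       = z≤n
  ... | yes _   | no _    = z≤n

  ∑-reps-* : ∀ a (g : Fin q → ℕ) → sum (λ x → reps a x * g x) ≡ ∑∑ (λ b c → W b c * g (v a b c))
  ∑-reps-* a g = begin
    sum (λ x → reps a x * g x)                               ≡⟨ sum-cong-≗ (λ x → ∑∑-*ʳ (g x) (λ b c → W b c * δ x (v a b c))) ⟩
    sum (λ x → ∑∑ (λ b c → (W b c * δ x (v a b c)) * g x))   ≡⟨ sum-cong-≗ (λ x → ∑∑-cong (λ b c → *-assoc (W b c) _ (g x))) ⟩
    sum (λ x → ∑∑ (λ b c → W b c * (δ x (v a b c) * g x)))   ≡⟨ ∑-∑∑-*ˡ W (λ x b c → δ x (v a b c) * g x) ⟩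
    ∑∑ (λ b c → W b c * sum (λ x → δ x (v a b c) * g x))     ≡⟨ ∑∑-cong (λ b c → cong (W b c *_) (∑-δ (v a b c) g)) ⟩
    ∑∑ (λ b c → W b c * g (v a b c))                         ∎
    where open ≡-Reasoning

  ∑-reps : ∀ a → sum (reps a) ≡ n * n
  ∑-reps a = begin
    sum (reps a)                  ≡⟨ sum-cong-≗ (λ x → *-identityʳ (reps a x)) ⟨
    sum (λ x → reps a x * 1)      ≡⟨ ∑-reps-* a (λ _ → 1) ⟩
    ∑∑ (λ b c → W b c * 1)        ≡⟨ ∑∑-cong (λ b c → *-identityʳ (W b c)) ⟩
    ∑∑ W                          ≡⟨ ∑∑W≡n² ⟩
    n * n                         ∎
    where open ≡-Reasoning

  inS-*-reps : ∀ a x → inS a x * reps a x ≡ reps a x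
  inS-*-reps a x = 𝟙-does-*-support (S? a x) (reps a x)
    (λ x∉S → ∑-zero (λ b → ∑-zero (λ c → term-vanishes b c (λ b,c → x∉S (b , c , b,c)))))
    where
    term-vanishes : ∀ b c → ¬ (b ∈ A × c ∈ A × x ≡ v a b c) → W b c * δ x (v a b c) ≡ 0
    term-vanishes b c ¬rep with b ∈? A | c ∈? A | x ≟ v a b c
    ... | yes b∈A | yes c∈A | yes x≡v = ⊥-elim (¬rep (b∈A , c∈A , x≡v))
    ... | yes _   | yes _   | no _    = refl
    ... | yes _   | no _    | _       = refl
    ... | no _    | _       | _       = refl

  n⁴≤∣S∣*collisions : ∀ a → (n * n) * (n * n) ≤ ∣ prodSumSet F A a ∣ * collisions a
  n⁴≤∣S∣*collisions a = subst₂ _≤_ (cong₂ _*_ ∑inS*reps ∑inS*reps) (cong (_* collisions a) ∑inS²)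
                                   (cauchy-schwarz (inS a) (reps a))
    where
    ∑inS*reps : sum (λ x → inS a x * reps a x) ≡ n * n
    ∑inS*reps = trans (sum-cong-≗ (inS-*-reps a)) (∑-reps a)
    ∑inS² : sum (λ x → inS a x * inS a x) ≡ ∣ prodSumSet F A a ∣
    ∑inS² = trans (sum-cong-≗ (λ x → 𝟙-idem (does (S? a x)))) (sym (∣S∣≡∑inS a))

  meets≤ : ∀ {b b'} c c' → b ∈ A → b' ∈ A → meets b c b' c' ≤ 1 + q * (δ b' b * δ c' c)
  meets≤ {b} {b'} c c' b∈A b'∈A with b' ≟ b | c' ≟ c
  ... | yes refl | yes refl = ≤-trans (∑-≤-card (λ a → 𝟙≤1 _))
                                      (≤-trans (≤-reflexive (sym (*-identityʳ q))) (m≤n+m _ 1))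
  ... | yes refl | no c'≢c  = ≤-trans (∑-unique≤1 (λ a → v a b c ≟ v a b c')
                                        (λ a _ meet _ → ⊥-elim (c'≢c (sym (*-+-cancelˡ a c c' b≢0 meet)))))
                                      (m≤m+n 1 _)
    where
    b≢0 : ¬ b ≡ 0#
    b≢0 refl = 0∉A b∈A
  ... | no b'≢b  | _        = ≤-trans (∑-unique≤1 (λ a → v a b c ≟ v a b' c')
                                        (λ a a' meet meet' → distinct-slopes-meet-once a a' c c' (b'≢b ∘ sym) meet meet'))
                                      (m≤m+n 1 _)

  ∑-collisions : sum collisions ≡ ∑∑ (λ b c → W b c * ∑∑ (λ b' c' → W b' c' * meets b c b' c'))
  ∑-collisions = begin
    sum collisions                                                  ≡⟨ sum-cong-≗ (λ a → ∑-reps-* a (reps a)) ⟩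
    sum (λ a → ∑∑ (λ b c → W b c * reps a (v a b c)))              ≡⟨ ∑-∑∑-*ˡ W (λ a b c → reps a (v a b c)) ⟩
    ∑∑ (λ b c → W b c * sum (λ a → reps a (v a b c)))              ≡⟨ ∑∑-cong (λ b c → cong (W b c *_)
                                                                         (∑-∑∑-*ˡ W (λ a b' c' → δ (v a b c) (v a b' c')))) ⟩
    ∑∑ (λ b c → W b c * ∑∑ (λ b' c' → W b' c' * meets b c b' c'))  ∎
    where open ≡-Reasoning

  ∑∑-W*[1+qδδ] : ∀ b c → ∑∑ (λ b' c' → W b' c' * (1 + q * (δ b' b * δ c' c))) ≡ n * n + q * W b c
  ∑∑-W*[1+qδδ] b c = begin
    ∑∑ (λ b' c' → W b' c' * (1 + q * (δ b' b * δ c' c)))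
      ≡⟨ ∑∑-cong (λ b' c' → split (χ b') (χ c') (δ b' b) (δ c' c) q) ⟩
    ∑∑ (λ b' c' → W b' c' + q * ((δ b' b * χ b') * (δ c' c * χ c')))
      ≡⟨ ∑∑-distrib-+ W (λ b' c' → q * ((δ b' b * χ b') * (δ c' c * χ c'))) ⟩
    ∑∑ W + ∑∑ (λ b' c' → q * ((δ b' b * χ b') * (δ c' c * χ c')))
      ≡⟨ cong₂ _+_ ∑∑W≡n² (∑∑-*ˡ q (λ b' c' → (δ b' b * χ b') * (δ c' c * χ c'))) ⟩
    n * n + q * ∑∑ (λ b' c' → (δ b' b * χ b') * (δ c' c * χ c'))
      ≡⟨ cong (λ t → n * n + q * t) (∑-*-∑ (λ b' → δ b' b * χ b') (λ c' → δ c' c * χ c')) ⟨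
    n * n + q * (sum (λ b' → δ b' b * χ b') * sum (λ c' → δ c' c * χ c'))
      ≡⟨ cong (λ t → n * n + q * t) (cong₂ _*_ (∑-δ b χ) (∑-δ c χ)) ⟩
    n * n + q * W b c ∎
    where
    open ≡-Reasoning
    split : ∀ x y d e q → (x * y) * (1 + q * (d * e)) ≡ x * y + q * ((d * x) * (e * y))
    split = solve-∀

  ∑∑-W*[n²+qW] : ∑∑ (λ b c → W b c * (n * n + q * W b c)) ≡ (n * n) * (n * n) + q * (n * n)
  ∑∑-W*[n²+qW] = begin
    ∑∑ (λ b c → W b c * (n * n + q * W b c))
      ≡⟨ ∑∑-cong (λ b c → split (W b c) (n * n) q) ⟩
    ∑∑ (λ b c → n * n * W b c + q * (W b c * W b c))
      ≡⟨ ∑∑-cong (λ b c → cong (λ t → n * n * W b c + q * t) (W-idem b c)) ⟩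
    ∑∑ (λ b c → n * n * W b c + q * W b c)
      ≡⟨ ∑∑-distrib-+ (λ b c → n * n * W b c) (λ b c → q * W b c) ⟩
    ∑∑ (λ b c → n * n * W b c) + ∑∑ (λ b c → q * W b c)
      ≡⟨ cong₂ _+_ (∑∑-*ˡ (n * n) W) (∑∑-*ˡ q W) ⟩
    n * n * ∑∑ W + q * ∑∑ W
      ≡⟨ cong (λ t → n * n * t + q * t) ∑∑W≡n² ⟩
    (n * n) * (n * n) + q * (n * n) ∎
    where
    open ≡-Reasoning
    split : ∀ w N q → w * (N + q * w) ≡ N * w + q * (w * w)
    split = solve-∀

  ∑-collisions≤ : sum collisions ≤ (n * n) * (n * n) + q * (n * n)
  ∑-collisions≤ = begin
    sum collisions
      ≡⟨ ∑-collisions ⟩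
    ∑∑ (λ b c → W b c * ∑∑ (λ b' c' → W b' c' * meets b c b' c'))
      ≤⟨ ∑∑-mono-≤ (λ b c → W-monoʳ-≤ b c λ b∈A _ →
           ∑∑-mono-≤ (λ b' c' → W-monoʳ-≤ b' c' λ b'∈A _ → meets≤ c c' b∈A b'∈A)) ⟩
    ∑∑ (λ b c → W b c * ∑∑ (λ b' c' → W b' c' * (1 + q * (δ b' b * δ c' c))))
      ≡⟨ ∑∑-cong (λ b c → cong (W b c *_) (∑∑-W*[1+qδδ] b c)) ⟩
    ∑∑ (λ b c → W b c * (n * n + q * W b c))
      ≡⟨ ∑∑-W*[n²+qW] ⟩
    (n * n) * (n * n) + q * (n * n) ∎
    where open ≤-Reasoning

  n⁴[1+χ]≤q*collisions : (∀ a → a ∈ A → 2 * ∣ prodSumSet F A a ∣ ≤ q) →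
                          ∀ a → (n * n) * (n * n) * (1 + χ a) ≤ q * collisions a
  n⁴[1+χ]≤q*collisions small a with a ∈? A
  ... | yes a∈A = begin
    (n * n) * (n * n) * 2                              ≡⟨ *-comm ((n * n) * (n * n)) 2 ⟩
    2 * ((n * n) * (n * n))                            ≤⟨ *-monoʳ-≤ 2 (n⁴≤∣S∣*collisions a) ⟩
    2 * (∣ prodSumSet F A a ∣ * collisions a)          ≡⟨ *-assoc 2 ∣ prodSumSet F A a ∣ (collisions a) ⟨
    2 * ∣ prodSumSet F A a ∣ * collisions a            ≤⟨ *-monoˡ-≤ (collisions a) (small a a∈A) ⟩
    q * collisions a                                   ∎
    where open ≤-Reasoning
  ... | no _ = begin
    (n * n) * (n * n) * 1                              ≡⟨ *-identityʳ _ ⟩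
    (n * n) * (n * n)                                  ≤⟨ n⁴≤∣S∣*collisions a ⟩
    ∣ prodSumSet F A a ∣ * collisions a                ≤⟨ *-monoˡ-≤ (collisions a) (∣p∣≤n (prodSumSet F A a)) ⟩
    q * collisions a                                   ∎
    where open ≤-Reasoning

  n³≤q² : (∀ a → a ∈ A → 2 * ∣ prodSumSet F A a ∣ ≤ q) → n ^ 3 ≤ q ^ 2
  n³≤q² small = m⁴[Q+m]≤Q[m⁴+Qm²]⇒m³≤Q² n q (begin
    n⁴ * (q + n)                        ≡⟨ cong (n⁴ *_) (cong₂ _+_ (∑-const-1 q) (sym (∣A∣≡∑ A))) ⟨
    n⁴ * (∑[ _ < q ] 1 + sum χ)         ≡⟨ cong (n⁴ *_) (∑-distrib-+ (λ _ → 1) χ) ⟨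
    n⁴ * sum (λ a → 1 + χ a)            ≡⟨ *-distribˡ-sum n⁴ (λ a → 1 + χ a) ⟩
    sum (λ a → n⁴ * (1 + χ a))          ≤⟨ ∑-mono-≤ (n⁴[1+χ]≤q*collisions small) ⟩
    sum (λ a → q * collisions a)        ≡⟨ *-distribˡ-sum q collisions ⟨
    q * sum collisions                  ≤⟨ *-monoʳ-≤ q ∑-collisions≤ ⟩
    q * (n⁴ + q * (n * n))              ∎)
    where
    open ≤-Reasoning
    n⁴ = (n * n) * (n * n)

-- The argument works over any finite field.
theorem7 : (q : ℕ) → IsPrimePower q → (F : FieldOn q) → (A : Subset q)
    → FieldOn.0# F ∉ A
    → q ^ 2 < ∣ A ∣ ^ 3
    → ∃ λ a → a ∈ A × q < 2 * ∣ prodSumSet F A a ∣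
theorem7 q _ F A 0∉A q²<∣A∣³ with any? (λ a → (a ∈? A) ×-dec (q <? 2 * ∣ prodSumSet F A a ∣))
... | yes large = large
... | no none    = contradiction (ProductSumCount.n³≤q² F A 0∉A small) (<⇒≱ q²<∣A∣³)
  where
  small : ∀ a → a ∈ A → 2 * ∣ prodSumSet F A a ∣ ≤ q
  small a a∈A = ≮⇒≥ (λ large → none (a , a∈A , large))
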